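{- Let $\lambda\vdash k$ and let $\tau$ be a transposition. Let $P_\lambda$ be the polynomial with $P_\lambda(n)=\chi^{(n-k,\lambda)}(\tau)$ for all $n\ge\max\{k+\lambda_1,2\}$ (where $\tau$ is viewed in $S_n$), and write \[P_\lambda(x)=\sum_{h=0}^{k}(-1)^h b^{(2)}_{\lambda,h}\binom{x-2}{k-h}.\] Then $b^{(2)}_{\lambda,h}=0$ for all $h$ with $\ell(\lambda)+2<h\le k$. In particular, $b^{(2)}_{\lambda,k}=0$ whenever $\ell(\lambda)<k-2$.
   Context: For $\mu\vdash n$, $\chi^\mu$ is the irreducible character of $S_n$ indexed by $\mu$; $(n-k,\lambda)$ is the partition of $n$ with first row $n-k$ followed by the rows of $\lambda$; $\ell(\lambda)$ is the number of parts of $\lambda$ and $\lambda_1$ its largest part. A transposition in $S_2$ is viewed in every $S_n$, $n\ge2$, via the standard embedding; the value $\chi^{(n-k,\lambda)}(\tau)$ is given, for $n\ge\max\{k+\lambda_1,2\}$, by a polynomial $P_\lambda$ of degree $k$ in $n$ (taken as given). -}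

module Defs where

open import Data.Bool using (Bool; true; false; if_then_else_; _∧_; not)
open import Data.Nat using (ℕ; zero; suc; _+_; _∸_; _≤_; _<_; _≡ᵇ_; _≤ᵇ_; _<ᵇ_)
open import Data.Nat.Combinatorics using (_C_)
open import Data.List using (List; []; _∷_; _++_; length; replicate)
open import Data.Nat.ListAction using (sum)
open import Data.Bool.ListAction using (any)
open import Data.List.Relation.Unary.All using (All)
open import Data.List.Relation.Unary.Linked using (Linked)
open import Data.Integer using (ℤ; +_; -_) renaming (_+_ to _+ℤ_; _*_ to _*ℤ_)
open import Data.Rational using (ℚ; 0ℚ; 1ℚ; _/_) renaming (_+_ to _+ℚ_; _*_ to _*ℚ_; -_ to -ℚ_)
open import Relation.Binary.PropositionalEquality using (_≡_)
open import Data.Product using (_×_)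

IsPartitionOf : List ℕ → ℕ → Set
IsPartitionOf μ k = All (0 <_) μ × Linked (λ a b → b ≤ a) μ × sum μ ≡ k

largestPart : List ℕ → ℕ
largestPart []      = 0
largestPart (m ∷ _) = m

-- Irreducible characters of S_n, via the Murnaghan–Nakayama rule
-- formulated on beta-sets (first-column hook lengths).  Removing a rim
-- hook of length r corresponds to moving a bead b to b ∸ r (needs r ≤ b and
-- b ∸ r not occupied); the leg length is the number of beads strictly
-- between b ∸ r and b.

betaSet : List ℕ → List ℕ
betaSet []       = []
betaSet (m ∷ ms) = (m + length ms) ∷ betaSet ms

member : ℕ → List ℕ → Bool
member x xs = any (λ y → y ≡ᵇ x) xs

countBetween : ℕ → ℕ → List ℕ → ℕ
countBetween lo hi []       = 0
countBetween lo hi (y ∷ ys) =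
  (if (lo <ᵇ y) ∧ (y <ᵇ hi) then 1 else 0) + countBetween lo hi ys

signℤ : ℕ → ℤ
signℤ zero          = + 1
signℤ (suc zero)    = - (+ 1)
signℤ (suc (suc h)) = signℤ h

moveBeads : (List ℕ → ℤ) → ℕ → List ℕ → List ℕ → ℤ
moveBeads f r done []         = + 0
moveBeads f r done (b ∷ rest) =
  (if (r ≤ᵇ b) ∧ not (member (b ∸ r) (done ++ b ∷ rest))
     then signℤ (countBetween (b ∸ r) b (done ++ rest)) *ℤ f (done ++ (b ∸ r) ∷ rest)
     else + 0)
  +ℤ moveBeads f r (b ∷ done) rest

mnβ : List ℕ → List ℕ → ℤ
mnβ β []      = + 1
mnβ β (r ∷ ρ) = moveBeads (λ β′ → mnβ β′ ρ) r [] β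

-- χ^μ evaluated at a permutation of cycle type ρ (a list of cycle lengths
-- summing to |μ|)
χ : List ℕ → List ℕ → ℤ
χ μ ρ = mnβ (betaSet μ) ρ

transpositionType : ℕ → List ℕ
transpositionType n = 2 ∷ replicate (n ∸ 2) 1

toℚ : ℤ → ℚ
toℚ i = i / 1

signℚ : ℕ → ℚ
signℚ h = toℚ (signℤ h)

Σ0to : ℕ → (ℕ → ℚ) → ℚ
Σ0to zero    f = f 0
Σ0to (suc k) f = Σ0to k f +ℚ f (suc k)

binomExpansion : ℕ → (ℕ → ℚ) → ℕ → ℚ
binomExpansion k b n =
  Σ0to k (λ h → signℚ h *ℚ (b h *ℚ toℚ (+ ((n ∸ 2) C (k ∸ h)))))

{-# OPTIONS --safe #-}
-- Write n = j + 2 and let B be the beta-set of λ, with ℓ = ℓ(λ) beads; the beta-set of (n - k, λ) is B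
-- with the head bead j - k + ℓ + 2 in front. In the Murnaghan–Nakayama rule one may let the beads move
-- independently and apply the sign of the sorting permutation once at the end: that sign is alternating,
-- so colliding moves cancel in pairs. The 2-hook is taken either from the head or from B, and each of the
-- j unit moves then lowers either the head or B. Choosing which J of them act on B gives
-- χ^(n-k,λ)(τ) = Σ_J C(n-2, J) c_J with c_J independent of n, and c_J = 0 unless the head can absorb the
-- other j - J moves, which forces J ≥ k - ℓ - 2. Since P_λ(n) = Σ_J C(n-2, J) (-1)^(k-J) b_(k-J) and the
-- binomial coefficients C(x, J) are linearly independent as functions of large x, b_h = 0 for h > ℓ + 2.
module Submission where

open import Algebra.Bundles using (CommutativeRing)
open import Data.Bool using (true; false; if_then_else_; _∧_; not)
open import Data.Nat using (ℕ; zero; suc; _∸_; _≤_; _<_; _≤′_; ≤′-refl; ≤′-step; z≤n; s≤s; _≤ᵇ_)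
import Data.Nat.Properties as ℕ
open import Data.Nat.Properties using (≤ᵇ-reflects-≤)
open import Data.Nat.Combinatorics using (_C_; nCk+nC[k+1]≡[n+1]C[k+1]; k>n⇒nCk≡0)
open import Function using (_∘_)
import Relation.Binary.PropositionalEquality as ≡
open import Relation.Nullary using (contradiction)
open import Relation.Nullary.Reflects using (Reflects; ofʸ; ofⁿ; fromEquivalence)

module BinomialSums {c ℓ} (R : CommutativeRing c ℓ) where

  open CommutativeRing R
  open import Algebra.Properties.Monoid.Mult +-monoid using (×-congˡ; ×-homo-+)
    renaming (_×_ to _·_)
  open import Algebra.Properties.AbelianGroup +-abelianGroup using (∙-cancelˡ; ∙-cancelʳ)
  open import Algebra.Properties.CommutativeSemigroup +-commutativeSemigroup
    using (interchange; x∙yz≈xz∙y)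
  open import Relation.Binary.Reasoning.Setoid setoid

  Σ≤ : ℕ → (ℕ → Carrier) → Carrier
  Σ≤ zero    f = f 0
  Σ≤ (suc K) f = Σ≤ K f + f (suc K)

  Σ≤-congᵇ : ∀ K {f g} → (∀ J → J ≤ K → f J ≈ g J) → Σ≤ K f ≈ Σ≤ K g
  Σ≤-congᵇ zero    f≈g = f≈g 0 z≤n
  Σ≤-congᵇ (suc K) f≈g =
    +-cong (Σ≤-congᵇ K (λ J J≤K → f≈g J (ℕ.m≤n⇒m≤1+n J≤K))) (f≈g (suc K) ℕ.≤-refl)

  Σ≤-cong : ∀ K {f g} → (∀ J → f J ≈ g J) → Σ≤ K f ≈ Σ≤ K g
  Σ≤-cong K f≈g = Σ≤-congᵇ K (λ J _ → f≈g J)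

  Σ≤-zero : ∀ K {f} → (∀ J → J ≤ K → f J ≈ 0#) → Σ≤ K f ≈ 0#
  Σ≤-zero zero    f≈0 = f≈0 0 z≤n
  Σ≤-zero (suc K) f≈0 = begin
    Σ≤ K _ + _  ≈⟨ +-cong (Σ≤-zero K (λ J J≤K → f≈0 J (ℕ.m≤n⇒m≤1+n J≤K)))
                          (f≈0 (suc K) ℕ.≤-refl) ⟩
    0# + 0#     ≈⟨ +-identityˡ 0# ⟩
    0#          ∎

  Σ≤-distrib-+ : ∀ K f g → Σ≤ K (λ J → f J + g J) ≈ Σ≤ K f + Σ≤ K g
  Σ≤-distrib-+ zero    f g = refl
  Σ≤-distrib-+ (suc K) f g = begin
    Σ≤ K (λ J → f J + g J) + (f (suc K) + g (suc K))  ≈⟨ +-congʳ (Σ≤-distrib-+ K f g) ⟩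
    (Σ≤ K f + Σ≤ K g) + (f (suc K) + g (suc K))      ≈⟨ interchange _ _ _ _ ⟩
    Σ≤ (suc K) f + Σ≤ (suc K) g                      ∎

  Σ≤-suc-front : ∀ K f → Σ≤ (suc K) f ≈ f 0 + Σ≤ K (f ∘ suc)
  Σ≤-suc-front zero    f = refl
  Σ≤-suc-front (suc K) f = begin
    Σ≤ (suc K) f + f (suc (suc K))              ≈⟨ +-congʳ (Σ≤-suc-front K f) ⟩
    (f 0 + Σ≤ K (f ∘ suc)) + f (suc (suc K))    ≈⟨ +-assoc _ _ _ ⟩
    f 0 + Σ≤ (suc K) (f ∘ suc)                  ∎

  Σ≤-pad : ∀ {K L} f → (∀ J → K < J → f J ≈ 0#) → K ≤ L → Σ≤ L f ≈ Σ≤ K f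
  Σ≤-pad {K} f f≈0 K≤L = go (ℕ.≤⇒≤′ K≤L)
    where
    go : ∀ {L} → K ≤′ L → Σ≤ L f ≈ Σ≤ K f
    go ≤′-refl          = refl
    go (≤′-step K≤′L) =
      trans (+-cong (go K≤′L) (f≈0 _ (s≤s (ℕ.≤′⇒≤ K≤′L)))) (+-identityʳ _)

  Σ≤-reverse : ∀ K f → Σ≤ K f ≈ Σ≤ K (λ J → f (K ∸ J))
  Σ≤-reverse zero    f = refl
  Σ≤-reverse (suc K) f = begin
    Σ≤ K f + f (suc K)                   ≈⟨ +-congʳ (Σ≤-reverse K f) ⟩
    Σ≤ K (λ J → f (K ∸ J)) + f (suc K)   ≈⟨ +-comm _ _ ⟩
    f (suc K) + Σ≤ K (λ J → f (K ∸ J))   ≈⟨ Σ≤-suc-front K (λ J → f (suc K ∸ J)) ⟨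
    Σ≤ (suc K) (λ J → f (suc K ∸ J))     ∎

  ι : ℕ → Carrier
  ι n = n · 1#

  binom : ℕ → ℕ → Carrier
  binom j J = ι (j C J)

  binom-0 : ∀ j → binom j 0 ≈ 1#
  binom-0 j = +-identityʳ 1#

  binom-pascal : ∀ j J → binom (suc j) (suc J) ≈ binom j J + binom j (suc J)
  binom-pascal j J =
    trans (×-congˡ (≡.sym (nCk+nC[k+1]≡[n+1]C[k+1] j J))) (×-homo-+ 1# (j C J) (j C suc J))

  binom-vanish : ∀ {j J} → j < J → binom j J ≈ 0#
  binom-vanish j<J = ×-congˡ (k>n⇒nCk≡0 j<J)

  binomialSum : ℕ → (ℕ → Carrier) → ℕ → Carrier
  binomialSum K a j = Σ≤ K (λ J → binom j J * a J)

  binomialSum-congᵇ : ∀ K {a b} j → (∀ J → J ≤ K → a J ≈ b J) →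
    binomialSum K a j ≈ binomialSum K b j
  binomialSum-congᵇ K j a≈b = Σ≤-congᵇ K (λ J J≤K → *-congˡ (a≈b J J≤K))

  binomialSum-distrib-+ : ∀ K a b j →
    binomialSum K (λ J → a J + b J) j ≈ binomialSum K a j + binomialSum K b j
  binomialSum-distrib-+ K a b j =
    trans (Σ≤-cong K (λ J → distribˡ (binom j J) (a J) (b J))) (Σ≤-distrib-+ K _ _)

  binomialSum-pad : ∀ {K L} a j → (∀ J → K < J → a J ≈ 0#) → K ≤ L →
    binomialSum L a j ≈ binomialSum K a j
  binomialSum-pad a j a≈0 = Σ≤-pad _ (λ J K<J → trans (*-congˡ (a≈0 J K<J)) (zeroʳ _))

  binomialSum-beyond : ∀ {L} a j → j ≤ L → binomialSum L a j ≈ binomialSum j a j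
  binomialSum-beyond a j = Σ≤-pad _ (λ J j<J → trans (*-congʳ (binom-vanish j<J)) (zeroˡ _))

  binomialSum-suc-front : ∀ K a j →
    binomialSum (suc K) a j ≈ a 0 + Σ≤ K (λ J → binom j (suc J) * a (suc J))
  binomialSum-suc-front K a j =
    trans (Σ≤-suc-front K _) (+-congʳ (trans (*-congʳ (binom-0 j)) (*-identityˡ (a 0))))

  binomialSum-pascal : ∀ K a j →
    binomialSum (suc K) a (suc j) ≈ binomialSum (suc K) a j + binomialSum K (a ∘ suc) j
  binomialSum-pascal K a j = begin
    binomialSum (suc K) a (suc j)
      ≈⟨ binomialSum-suc-front K a (suc j) ⟩
    a 0 + Σ≤ K (λ J → binom (suc j) (suc J) * a (suc J))
      ≈⟨ +-congˡ (Σ≤-cong K (λ J → trans (*-congʳ (binom-pascal j J)) (distribʳ _ _ _))) ⟩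
    a 0 + Σ≤ K (λ J → binom j J * a (suc J) + binom j (suc J) * a (suc J))
      ≈⟨ +-congˡ (Σ≤-distrib-+ K _ _) ⟩
    a 0 + (binomialSum K (a ∘ suc) j + Σ≤ K (λ J → binom j (suc J) * a (suc J)))
      ≈⟨ x∙yz≈xz∙y _ _ _ ⟩
    (a 0 + Σ≤ K (λ J → binom j (suc J) * a (suc J))) + binomialSum K (a ∘ suc) j
      ≈⟨ +-congʳ (binomialSum-suc-front K a j) ⟨
    binomialSum (suc K) a j + binomialSum K (a ∘ suc) j
      ∎

  binomialSum-injective : ∀ K {a b} M → (∀ j → M ≤ j → binomialSum K a j ≈ binomialSum K b j) →
    ∀ J → J ≤ K → a J ≈ b J
  binomialSum-injective zero {a} {b} M a≈b .0 z≤n = begin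
    a 0                 ≈⟨ *-identityˡ (a 0) ⟨
    1# * a 0            ≈⟨ *-congʳ (binom-0 M) ⟨
    binomialSum 0 a M   ≈⟨ a≈b M ℕ.≤-refl ⟩
    binomialSum 0 b M   ≈⟨ *-congʳ (binom-0 M) ⟩
    1# * b 0            ≈⟨ *-identityˡ (b 0) ⟩
    b 0                 ∎
  binomialSum-injective (suc K) {a} {b} M a≈b = agree
    where
    tails : ∀ j → M ≤ j → binomialSum K (a ∘ suc) j ≈ binomialSum K (b ∘ suc) j
    tails j M≤j = ∙-cancelˡ (binomialSum (suc K) a j) _ _ (begin
      binomialSum (suc K) a j + binomialSum K (a ∘ suc) j  ≈⟨ binomialSum-pascal K a j ⟨
      binomialSum (suc K) a (suc j)                        ≈⟨ a≈b (suc j) (ℕ.m≤n⇒m≤1+n M≤j) ⟩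
      binomialSum (suc K) b (suc j)                        ≈⟨ binomialSum-pascal K b j ⟩
      binomialSum (suc K) b j + binomialSum K (b ∘ suc) j  ≈⟨ +-congʳ (a≈b j M≤j) ⟨
      binomialSum (suc K) a j + binomialSum K (b ∘ suc) j  ∎)
    agree-suc : ∀ J → J ≤ K → a (suc J) ≈ b (suc J)
    agree-suc = binomialSum-injective K M tails
    agree : ∀ J → J ≤ suc K → a J ≈ b J
    agree (suc J) (s≤s J≤K) = agree-suc J J≤K
    agree zero    _         = ∙-cancelʳ (Σ≤ K (λ J → binom M (suc J) * b (suc J))) _ _ (begin
      a 0 + Σ≤ K (λ J → binom M (suc J) * b (suc J))
        ≈⟨ +-congˡ (Σ≤-congᵇ K (λ J J≤K → *-congˡ (agree-suc J J≤K))) ⟨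
      a 0 + Σ≤ K (λ J → binom M (suc J) * a (suc J))
        ≈⟨ binomialSum-suc-front K a M ⟨
      binomialSum (suc K) a M
        ≈⟨ a≈b M ℕ.≤-refl ⟩
      binomialSum (suc K) b M
        ≈⟨ binomialSum-suc-front K b M ⟩
      b 0 + Σ≤ K (λ J → binom M (suc J) * b (suc J))
        ∎)

  zeroAbove : ℕ → (ℕ → Carrier) → ℕ → Carrier
  zeroAbove K a J = if J ≤ᵇ K then a J else 0#

  zeroAbove-≤ : ∀ {K} a {J} → J ≤ K → zeroAbove K a J ≈ a J
  zeroAbove-≤ {K} a {J} J≤K with J ≤ᵇ K | ≤ᵇ-reflects-≤ J K
  ... | true  | _       = refl
  ... | false | ofⁿ J≰K = contradiction J≤K J≰K

  zeroAbove-> : ∀ {K} a {J} → K < J → zeroAbove K a J ≈ 0#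
  zeroAbove-> {K} a {J} K<J with J ≤ᵇ K | ≤ᵇ-reflects-≤ J K
  ... | false | _       = refl
  ... | true  | ofʸ J≤K = contradiction J≤K (ℕ.<⇒≱ K<J)

  binomialSum-injective′ : ∀ {K L a b} M → K ≤ L →
    (∀ j → M ≤ j → binomialSum K a j ≈ binomialSum L b j) → ∀ J → J ≤ K → a J ≈ b J
  binomialSum-injective′ {K} {L} {a} {b} M K≤L a≈b J J≤K =
    trans (sym (zeroAbove-≤ a J≤K)) (binomialSum-injective L M extended J (ℕ.≤-trans J≤K K≤L))
    where
    extended : ∀ j → M ≤ j → binomialSum L (zeroAbove K a) j ≈ binomialSum L b j
    extended j M≤j = begin
      binomialSum L (zeroAbove K a) j  ≈⟨ binomialSum-pad (zeroAbove K a) j (λ J → zeroAbove-> a) K≤L ⟩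
      binomialSum K (zeroAbove K a) j  ≈⟨ binomialSum-congᵇ K j (λ J → zeroAbove-≤ a) ⟩
      binomialSum K a j                ≈⟨ a≈b j M≤j ⟩
      binomialSum L b j                ∎

open import Defs
open import Data.Nat using (ℕ; _+_; _∸_; _≤_; _<_)
open import Data.List using (List; _∷_; length)
open import Data.Rational using (ℚ; 0ℚ)
open import Data.Product using (_×_)
open import Relation.Binary.PropositionalEquality using (_≡_)

open import Data.Integer using (ℤ; +_; -_; -[1+_]; 0ℤ; 1ℤ; -1ℤ) renaming (_+_ to _+ℤ_; _*_ to _*ℤ_)
import Data.Integer.Properties as ℤ
open import Data.Integer.Tactic.RingSolver using (solve-∀)
open import Algebra.Properties.CommutativeSemigroup ℤ.*-commutativeSemigroup using (x∙yz≈y∙xz)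
open import Data.List using ([]; _++_; [_]; map; replicate; reverse)
import Data.List.Properties as List
open import Data.List.Membership.Propositional using (_∈_; _∉_)
open import Data.List.Membership.Propositional.Properties using (∈-++⁻; ∈-++⁺ˡ; ∈-++⁺ʳ; ∈-∃++)
open import Data.List.Relation.Binary.Permutation.Propositional using (_↭_; ↭-sym; ↭-trans; prep; swap)
  renaming (refl to ↭-refl′; trans to ↭-trans′)
open import Data.List.Relation.Binary.Permutation.Propositional.Properties
  using (↭-reverse; ++⁺ʳ; shift; ∈-resp-↭; map⁺)
open import Data.List.Relation.Unary.All using (All; []; _∷_)
open import Data.List.Relation.Unary.AllPairs using (AllPairs; []; _∷_)
open import Data.List.Relation.Unary.Any using (here; there)
import Data.List.Relation.Unary.Any as Any
open import Data.List.Relation.Unary.Any.Properties using (any⁺; any⁻)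
open import Data.List.Relation.Unary.Linked using (Linked; []; [-]; _∷_)
open import Data.List.Relation.Unary.Linked.Properties using (Linked⇒AllPairs)
open import Data.Nat using (_<ᵇ_; _>_; _≥_)
open import Data.Nat.Properties using (<ᵇ-reflects-<)
open import Data.Nat.ListAction using (sum)
open import Data.Nat.ListAction.Properties using (sum-↭)
import Data.Nat.Tactic.RingSolver as ℕ-Solver
open import Data.Product using (_,_)
open import Data.Rational using (1ℚ; toℚᵘ) renaming (_+_ to _+ℚ_; _*_ to _*ℚ_)
import Data.Rational.Properties as ℚ
import Data.Rational.Unnormalised as ℚᵘ
import Data.Rational.Unnormalised.Properties as ℚᵘ
open import Data.Sum using (inj₁; inj₂)
open import Relation.Binary.PropositionalEquality
  using (refl; sym; trans; cong; cong₂; subst; _≢_; module ≡-Reasoning)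

signℤ-suc : ∀ h → signℤ (suc h) ≡ - signℤ h
signℤ-suc zero          = refl
signℤ-suc (suc zero)    = refl
signℤ-suc (suc (suc h)) = signℤ-suc h

signℤ-+ : ∀ g h → signℤ (g + h) ≡ signℤ g *ℤ signℤ h
signℤ-+ zero    h = sym (ℤ.*-identityˡ (signℤ h))
signℤ-+ (suc g) h = begin
  signℤ (suc (g + h))          ≡⟨ signℤ-suc (g + h) ⟩
  - signℤ (g + h)              ≡⟨ cong -_ (signℤ-+ g h) ⟩
  - (signℤ g *ℤ signℤ h)       ≡⟨ ℤ.neg-distribˡ-* (signℤ g) (signℤ h) ⟩
  - signℤ g *ℤ signℤ h         ≡⟨ cong (_*ℤ signℤ h) (signℤ-suc g) ⟨
  signℤ (suc g) *ℤ signℤ h     ∎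
  where open ≡-Reasoning

signℤ-square : ∀ h → signℤ h *ℤ signℤ h ≡ 1ℤ
signℤ-square zero          = refl
signℤ-square (suc zero)    = refl
signℤ-square (suc (suc h)) = signℤ-square h

cmpSign : ℕ → ℕ → ℤ
cmpSign zero    zero    = 0ℤ
cmpSign zero    (suc n) = -1ℤ
cmpSign (suc m) zero    = 1ℤ
cmpSign (suc m) (suc n) = cmpSign m n

cmpSign-anti : ∀ m n → cmpSign n m ≡ - cmpSign m n
cmpSign-anti zero    zero    = refl
cmpSign-anti zero    (suc n) = refl
cmpSign-anti (suc m) zero    = refl
cmpSign-anti (suc m) (suc n) = cmpSign-anti m n

cmpSign-< : ∀ {m n} → m < n → cmpSign m n ≡ -1ℤ
cmpSign-< {zero}  {suc n} _         = refl
cmpSign-< {suc m} {suc n} (s≤s m<n) = cmpSign-< m<n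

cmpSign-> : ∀ {m n} → n < m → cmpSign m n ≡ 1ℤ
cmpSign-> {m} {n} n<m = trans (cmpSign-anti n m) (cong -_ (cmpSign-< n<m))

cmpSignsʳ : ℕ → List ℕ → ℤ
cmpSignsʳ v []      = 1ℤ
cmpSignsʳ v (w ∷ ρ) = cmpSign v w *ℤ cmpSignsʳ v ρ

cmpSignsˡ : List ℕ → ℕ → ℤ
cmpSignsˡ []      v = 1ℤ
cmpSignsˡ (z ∷ π) v = cmpSign z v *ℤ cmpSignsˡ π v

-- The sign of the permutation sorting β into decreasing order, and 0 if β has a repeated entry.
sortSign : List ℕ → ℤ
sortSign []      = 1ℤ
sortSign (z ∷ γ) = cmpSignsʳ z γ *ℤ sortSign γ

cmpSignsʳ-insert : ∀ z π v ρ → cmpSignsʳ z (π ++ v ∷ ρ) ≡ cmpSign z v *ℤ cmpSignsʳ z (π ++ ρ)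
cmpSignsʳ-insert z []      v ρ = refl
cmpSignsʳ-insert z (w ∷ π) v ρ rewrite cmpSignsʳ-insert z π v ρ =
  x∙yz≈y∙xz (cmpSign z w) (cmpSign z v) (cmpSignsʳ z (π ++ ρ))

sortSign-insert : ∀ π v ρ →
  sortSign (π ++ v ∷ ρ) ≡ cmpSignsˡ π v *ℤ (cmpSignsʳ v ρ *ℤ sortSign (π ++ ρ))
sortSign-insert []      v ρ = sym (ℤ.*-identityˡ _)
sortSign-insert (z ∷ π) v ρ rewrite cmpSignsʳ-insert z π v ρ | sortSign-insert π v ρ =
  rearrange (cmpSign z v) (cmpSignsʳ z (π ++ ρ)) (cmpSignsˡ π v) (cmpSignsʳ v ρ) (sortSign (π ++ ρ))
  where
  rearrange : ∀ a p q s t → (a *ℤ p) *ℤ (q *ℤ (s *ℤ t)) ≡ (a *ℤ q) *ℤ (s *ℤ (p *ℤ t))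
  rearrange = solve-∀

Alternating : (List ℕ → ℤ) → Set
Alternating G = ∀ π x y β → G (π ++ x ∷ y ∷ β) ≡ - G (π ++ y ∷ x ∷ β)

SwapInvariant : (List ℕ → ℤ) → Set
SwapInvariant G = ∀ π x y β → G (π ++ x ∷ y ∷ β) ≡ G (π ++ y ∷ x ∷ β)

cmpSignsʳ-swap : ∀ z π x y β → cmpSignsʳ z (π ++ x ∷ y ∷ β) ≡ cmpSignsʳ z (π ++ y ∷ x ∷ β)
cmpSignsʳ-swap z []      x y β = x∙yz≈y∙xz (cmpSign z x) (cmpSign z y) (cmpSignsʳ z β)
cmpSignsʳ-swap z (w ∷ π) x y β = cong (cmpSign z w *ℤ_) (cmpSignsʳ-swap z π x y β)

sortSign-alternating : Alternating sortSign
sortSign-alternating []      x y β rewrite cmpSign-anti x y =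
  rearrange (cmpSign x y) (cmpSignsʳ x β) (cmpSignsʳ y β) (sortSign β)
  where
  rearrange : ∀ a p q t → (a *ℤ p) *ℤ (q *ℤ t) ≡ - ((- a *ℤ q) *ℤ (p *ℤ t))
  rearrange = solve-∀
sortSign-alternating (z ∷ π) x y β
  rewrite cmpSignsʳ-swap z π x y β | sortSign-alternating π x y β =
  sym (ℤ.neg-distribʳ-* (cmpSignsʳ z (π ++ y ∷ x ∷ β)) (sortSign (π ++ y ∷ x ∷ β)))

x≡-x⇒x≡0 : ∀ {a} → a ≡ - a → a ≡ 0ℤ
x≡-x⇒x≡0 {+ zero}   _  = refl
x≡-x⇒x≡0 {+ suc n}  ()
x≡-x⇒x≡0 { -[1+ n ]} ()

alternating-repeat : ∀ G → Alternating G → ∀ π x σ β → G (π ++ x ∷ σ ++ x ∷ β) ≡ 0ℤ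
alternating-repeat G alt π x []      β = x≡-x⇒x≡0 (alt π x x β)
alternating-repeat G alt π x (s ∷ σ) β = begin
  G (π ++ x ∷ s ∷ σ ++ x ∷ β)           ≡⟨ alt π x s (σ ++ x ∷ β) ⟩
  - G (π ++ s ∷ x ∷ σ ++ x ∷ β)         ≡⟨ cong (-_ ∘ G) (List.++-assoc π [ s ] (x ∷ σ ++ x ∷ β)) ⟨
  - G ((π ++ [ s ]) ++ x ∷ σ ++ x ∷ β)  ≡⟨ cong -_ (alternating-repeat G alt (π ++ [ s ]) x σ β) ⟩
  - 0ℤ                                  ∎
  where open ≡-Reasoning

alternating-∈ : ∀ G → Alternating G → ∀ π {v} ρ → v ∈ π ++ ρ → G (π ++ v ∷ ρ) ≡ 0ℤ
alternating-∈ G alt π {v} ρ v∈ with ∈-++⁻ π v∈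
... | inj₁ v∈π with σ , τ , refl ← ∈-∃++ v∈π =
  trans (cong G (List.++-assoc σ (v ∷ τ) (v ∷ ρ))) (alternating-repeat G alt σ v τ ρ)
... | inj₂ v∈ρ with σ , τ , refl ← ∈-∃++ v∈ρ = alternating-repeat G alt π v σ τ

alternating-* : ∀ G H → Alternating G → Alternating H → SwapInvariant (λ β → G β *ℤ H β)
alternating-* G H altG altH π x y β
  rewrite altG π x y β | altH π x y β = neg*neg (G (π ++ y ∷ x ∷ β)) (H (π ++ y ∷ x ∷ β))
  where
  neg*neg : ∀ a b → - a *ℤ - b ≡ a *ℤ b
  neg*neg = solve-∀

swapInvariant-↭ : ∀ G → SwapInvariant G → ∀ π {β γ} → β ↭ γ → G (π ++ β) ≡ G (π ++ γ)
swapInvariant-↭ G inv π ↭-refl′ = refl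
swapInvariant-↭ G inv π (prep {xs} {ys} x p) = begin
  G (π ++ x ∷ xs)      ≡⟨ cong G (List.++-assoc π [ x ] xs) ⟨
  G ((π ++ [ x ]) ++ xs) ≡⟨ swapInvariant-↭ G inv (π ++ [ x ]) p ⟩
  G ((π ++ [ x ]) ++ ys) ≡⟨ cong G (List.++-assoc π [ x ] ys) ⟩
  G (π ++ x ∷ ys)      ∎
  where open ≡-Reasoning
swapInvariant-↭ G inv π (swap {xs} {ys} x y p) = begin
  G (π ++ x ∷ y ∷ xs)          ≡⟨ inv π x y xs ⟩
  G (π ++ y ∷ x ∷ xs)          ≡⟨ cong G (List.++-assoc π (y ∷ x ∷ []) xs) ⟨
  G ((π ++ y ∷ x ∷ []) ++ xs)  ≡⟨ swapInvariant-↭ G inv (π ++ y ∷ x ∷ []) p ⟩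
  G ((π ++ y ∷ x ∷ []) ++ ys)  ≡⟨ cong G (List.++-assoc π (y ∷ x ∷ []) ys) ⟩
  G (π ++ y ∷ x ∷ ys)          ∎
  where open ≡-Reasoning
swapInvariant-↭ G inv π (↭-trans′ p q) =
  trans (swapInvariant-↭ G inv π p) (swapInvariant-↭ G inv π q)

Σ-lower : ℕ → (List ℕ → ℤ) → List ℕ → ℤ
Σ-lower r f []      = 0ℤ
Σ-lower r f (z ∷ β) = (if r ≤ᵇ z then f ((z ∸ r) ∷ β) else 0ℤ) +ℤ Σ-lower r (f ∘ (z ∷_)) β

-- Murnaghan–Nakayama without collision tests or leg signs: beads are lowered independently and the
-- sign of sorting is applied once, at the end.
mnAlt : List ℕ → List ℕ → ℤ
mnAlt β []      = sortSign β
mnAlt β (r ∷ ρ) = Σ-lower r (λ γ → mnAlt γ ρ) β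

if-neg : ∀ c {a b} → a ≡ - b → (if c then a else 0ℤ) ≡ - (if c then b else 0ℤ)
if-neg true  a≡-b = a≡-b
if-neg false _    = refl

Σ-lower-cong : ∀ r {f g} β → (∀ γ → f γ ≡ g γ) → Σ-lower r f β ≡ Σ-lower r g β
Σ-lower-cong r []      f≡g = refl
Σ-lower-cong r (z ∷ β) f≡g =
  cong₂ _+ℤ_ (cong (λ t → if r ≤ᵇ z then t else 0ℤ) (f≡g _)) (Σ-lower-cong r β (f≡g ∘ (z ∷_)))

Σ-lower-neg : ∀ r {f g} β → (∀ γ → f γ ≡ - g γ) → Σ-lower r f β ≡ - Σ-lower r g β
Σ-lower-neg r         []      f≡-g = refl
Σ-lower-neg r {g = g} (z ∷ β) f≡-g =
  trans (cong₂ _+ℤ_ (if-neg (r ≤ᵇ z) (f≡-g _)) (Σ-lower-neg r β (f≡-g ∘ (z ∷_))))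
        (sym (ℤ.neg-distrib-+ (if r ≤ᵇ z then g ((z ∸ r) ∷ β) else 0ℤ)
                              (Σ-lower r (g ∘ (z ∷_)) β)))

Σ-lower-alternating : ∀ r {G} → Alternating G → Alternating (Σ-lower r G)
Σ-lower-alternating r {G} alt [] x y β = trans
  (cong₂ _+ℤ_ (if-neg (r ≤ᵇ x) (alt [] (x ∸ r) y β))
              (cong₂ _+ℤ_ (if-neg (r ≤ᵇ y) (alt [] x (y ∸ r) β)) (Σ-lower-neg r β (alt [] x y))))
  (rearrange (if r ≤ᵇ x then G (y ∷ (x ∸ r) ∷ β) else 0ℤ)
             (if r ≤ᵇ y then G ((y ∸ r) ∷ x ∷ β) else 0ℤ)
             (Σ-lower r (λ γ → G (y ∷ x ∷ γ)) β))
  where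
  rearrange : ∀ a b c → - a +ℤ (- b +ℤ - c) ≡ - (b +ℤ (a +ℤ c))
  rearrange = solve-∀
Σ-lower-alternating r {G} alt (z ∷ π) x y β = trans
  (cong₂ _+ℤ_ (if-neg (r ≤ᵇ z) (alt ((z ∸ r) ∷ π) x y β))
              (Σ-lower-alternating r {G ∘ (z ∷_)} (alt ∘ (z ∷_)) π x y β))
  (sym (ℤ.neg-distrib-+ (if r ≤ᵇ z then G ((z ∸ r) ∷ π ++ y ∷ x ∷ β) else 0ℤ)
                        (Σ-lower r (G ∘ (z ∷_)) (π ++ y ∷ x ∷ β))))

mnAlt-alternating : ∀ ρ → Alternating (λ β → mnAlt β ρ)
mnAlt-alternating []      = sortSign-alternating
mnAlt-alternating (r ∷ ρ) = Σ-lower-alternating r (mnAlt-alternating ρ)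

between : ℕ → ℕ → ℕ → ℕ
between lo hi y = if (lo <ᵇ y) ∧ (y <ᵇ hi) then 1 else 0

countBetween-++ : ∀ lo hi A B →
  countBetween lo hi (A ++ B) ≡ countBetween lo hi A + countBetween lo hi B
countBetween-++ lo hi []      B = refl
countBetween-++ lo hi (y ∷ A) B = trans (cong (_+_ (between lo hi y)) (countBetween-++ lo hi A B))
                                        (sym (ℕ.+-assoc (between lo hi y) _ _))

countBetween≡sum : ∀ lo hi A → countBetween lo hi A ≡ sum (map (between lo hi) A)
countBetween≡sum lo hi []      = refl
countBetween≡sum lo hi (y ∷ A) = cong (_+_ (between lo hi y)) (countBetween≡sum lo hi A)

countBetween-↭ : ∀ lo hi {A B} → A ↭ B → countBetween lo hi A ≡ countBetween lo hi B
countBetween-↭ lo hi {A} {B} A↭B = begin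
  countBetween lo hi A          ≡⟨ countBetween≡sum lo hi A ⟩
  sum (map (between lo hi) A)   ≡⟨ sum-↭ (map⁺ (between lo hi) A↭B) ⟩
  sum (map (between lo hi) B)   ≡⟨ countBetween≡sum lo hi B ⟨
  countBetween lo hi B          ∎
  where open ≡-Reasoning

cmpSign-lowerˡ : ∀ {b′ b} z → b′ < b → z ≢ b → z ≢ b′ →
  cmpSign z b ≡ signℤ (between b′ b z) *ℤ cmpSign z b′
cmpSign-lowerˡ {b′} {b} z b′<b z≢b z≢b′
  with b′ <ᵇ z | <ᵇ-reflects-< b′ z | z <ᵇ b | <ᵇ-reflects-< z b
... | false | ofⁿ b′≮z | _     | _     =
  trans (cmpSign-< (ℕ.<-trans z<b′ b′<b)) (sym (trans (ℤ.*-identityˡ _) (cmpSign-< z<b′)))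
  where z<b′ = ℕ.≤∧≢⇒< (ℕ.≮⇒≥ b′≮z) z≢b′
... | true  | ofʸ b′<z | true  | ofʸ z<b
  rewrite cmpSign-< z<b | cmpSign-> b′<z = refl
... | true  | ofʸ b′<z | false | ofⁿ z≮b
  rewrite cmpSign-> (ℕ.≤∧≢⇒< (ℕ.≮⇒≥ z≮b) (z≢b ∘ sym)) | cmpSign-> b′<z = refl

cmpSign-lowerʳ : ∀ {b′ b} w → b′ < b → w ≢ b → w ≢ b′ →
  cmpSign b w ≡ signℤ (between b′ b w) *ℤ cmpSign b′ w
cmpSign-lowerʳ {b′} {b} w b′<b w≢b w≢b′ = begin
  cmpSign b w                                  ≡⟨ cmpSign-anti w b ⟩
  - cmpSign w b                                ≡⟨ cong -_ (cmpSign-lowerˡ w b′<b w≢b w≢b′) ⟩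
  - (signℤ (between b′ b w) *ℤ cmpSign w b′)   ≡⟨ ℤ.neg-distribʳ-* (signℤ (between b′ b w)) _ ⟩
  signℤ (between b′ b w) *ℤ - cmpSign w b′     ≡⟨ cong (signℤ (between b′ b w) *ℤ_) (cmpSign-anti w b′) ⟨
  signℤ (between b′ b w) *ℤ cmpSign b′ w       ∎
  where open ≡-Reasoning

signℤ-*-combine : ∀ s c {p q x y} → p ≡ signℤ s *ℤ q → x ≡ signℤ c *ℤ y →
  p *ℤ x ≡ signℤ (s + c) *ℤ (q *ℤ y)
signℤ-*-combine s c refl refl rewrite signℤ-+ s c = rearrange (signℤ s) _ (signℤ c) _
  where
  rearrange : ∀ a q b y → (a *ℤ q) *ℤ (b *ℤ y) ≡ (a *ℤ b) *ℤ (q *ℤ y)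
  rearrange = solve-∀

∉-head : ∀ {v z : ℕ} {l} → v ∉ z ∷ l → z ≢ v
∉-head v∉ z≡v = v∉ (here (sym z≡v))

cmpSignsˡ-lower : ∀ {b′ b} π → b′ < b → b ∉ π → b′ ∉ π →
  cmpSignsˡ π b ≡ signℤ (countBetween b′ b π) *ℤ cmpSignsˡ π b′
cmpSignsˡ-lower []      b′<b b∉ b′∉ = refl
cmpSignsˡ-lower {b′} {b} (z ∷ π) b′<b b∉ b′∉ =
  signℤ-*-combine (between b′ b z) (countBetween b′ b π)
    (cmpSign-lowerˡ z b′<b (∉-head b∉) (∉-head b′∉))
    (cmpSignsˡ-lower π b′<b (b∉ ∘ there) (b′∉ ∘ there))

cmpSignsʳ-lower : ∀ {b′ b} ρ → b′ < b → b ∉ ρ → b′ ∉ ρ →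
  cmpSignsʳ b ρ ≡ signℤ (countBetween b′ b ρ) *ℤ cmpSignsʳ b′ ρ
cmpSignsʳ-lower []      b′<b b∉ b′∉ = refl
cmpSignsʳ-lower {b′} {b} (w ∷ ρ) b′<b b∉ b′∉ =
  signℤ-*-combine (between b′ b w) (countBetween b′ b ρ)
    (cmpSign-lowerʳ w b′<b (∉-head b∉) (∉-head b′∉))
    (cmpSignsʳ-lower ρ b′<b (b∉ ∘ there) (b′∉ ∘ there))

sortSign-lower : ∀ {b′ b} π ρ → b′ < b → b ∉ π ++ ρ → b′ ∉ π ++ ρ →
  sortSign (π ++ b ∷ ρ) ≡ signℤ (countBetween b′ b (π ++ ρ)) *ℤ sortSign (π ++ b′ ∷ ρ)
sortSign-lower {b′} {b} π ρ b′<b b∉ b′∉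
  rewrite sortSign-insert π b ρ | sortSign-insert π b′ ρ | countBetween-++ b′ b π ρ
        | cmpSignsˡ-lower π b′<b (b∉ ∘ ∈-++⁺ˡ) (b′∉ ∘ ∈-++⁺ˡ)
        | cmpSignsʳ-lower ρ b′<b (b∉ ∘ ∈-++⁺ʳ π) (b′∉ ∘ ∈-++⁺ʳ π)
        | signℤ-+ (countBetween b′ b π) (countBetween b′ b ρ) =
  rearrange (signℤ (countBetween b′ b π)) (cmpSignsˡ π b′)
            (signℤ (countBetween b′ b ρ)) (cmpSignsʳ b′ ρ) (sortSign (π ++ ρ))
  where
  rearrange : ∀ a p c q t → (a *ℤ p) *ℤ ((c *ℤ q) *ℤ t) ≡ (a *ℤ c) *ℤ (p *ℤ (q *ℤ t))
  rearrange = solve-∀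

-- sortSign β is ±1 exactly when the entries of β are distinct.
Distinct : List ℕ → Set
Distinct β = sortSign β *ℤ sortSign β ≡ 1ℤ

sortSign²-swapInvariant : SwapInvariant (λ β → sortSign β *ℤ sortSign β)
sortSign²-swapInvariant = alternating-* sortSign sortSign sortSign-alternating sortSign-alternating

distinct-↭ : ∀ {β γ} → β ↭ γ → Distinct β → Distinct γ
distinct-↭ β↭γ =
  trans (sym (swapInvariant-↭ (λ β → sortSign β *ℤ sortSign β) sortSign²-swapInvariant [] β↭γ))

distinct⇒∉ : ∀ π {v} ρ → Distinct (π ++ v ∷ ρ) → v ∉ π ++ ρ
distinct⇒∉ π ρ d v∈
  with trans (sym (cong (λ s → s *ℤ s) (alternating-∈ sortSign sortSign-alternating π ρ v∈))) d
... | ()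

distinct-lower : ∀ {b′ b} π ρ → b′ < b → b′ ∉ π ++ ρ →
  Distinct (π ++ b ∷ ρ) → Distinct (π ++ b′ ∷ ρ)
distinct-lower {b′} {b} π ρ b′<b b′∉ d = begin
  s′ *ℤ s′
    ≡⟨ ℤ.*-identityˡ (s′ *ℤ s′) ⟨
  1ℤ *ℤ (s′ *ℤ s′)
    ≡⟨ cong (_*ℤ (s′ *ℤ s′)) (signℤ-square c) ⟨
  (signℤ c *ℤ signℤ c) *ℤ (s′ *ℤ s′)
    ≡⟨ rearrange (signℤ c) s′ ⟩
  (signℤ c *ℤ s′) *ℤ (signℤ c *ℤ s′)
    ≡⟨ cong (λ t → t *ℤ t) (sortSign-lower π ρ b′<b (distinct⇒∉ π ρ d) b′∉) ⟨
  sortSign (π ++ b ∷ ρ) *ℤ sortSign (π ++ b ∷ ρ)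
    ≡⟨ d ⟩
  1ℤ
    ∎
  where
  open ≡-Reasoning
  c : ℕ
  c = countBetween b′ b (π ++ ρ)
  s′ : ℤ
  s′ = sortSign (π ++ b′ ∷ ρ)
  rearrange : ∀ a x → (a *ℤ a) *ℤ (x *ℤ x) ≡ (a *ℤ x) *ℤ (a *ℤ x)
  rearrange = solve-∀

signedAlt : List ℕ → List ℕ → ℤ
signedAlt ρ β = sortSign β *ℤ mnAlt β ρ

signedAlt-↭ : ∀ ρ {β γ} → β ↭ γ → signedAlt ρ β ≡ signedAlt ρ γ
signedAlt-↭ ρ = swapInvariant-↭ (signedAlt ρ)
  (alternating-* sortSign (λ β → mnAlt β ρ) sortSign-alternating (mnAlt-alternating ρ)) []

member-reflects : ∀ v l → Reflects (v ∈ l) (member v l)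
member-reflects v l = fromEquivalence
  (Any.map (λ y≡ᵇv → sym (ℕ.≡ᵇ⇒≡ _ v y≡ᵇv)) ∘ any⁻ _ l)
  (any⁺ _ ∘ Any.map (λ v≡y → ℕ.≡⇒≡ᵇ _ v (sym v≡y)))

reverse-++-↭ : ∀ π (v : ℕ) ρ → reverse π ++ v ∷ ρ ↭ v ∷ π ++ ρ
reverse-++-↭ π v ρ = ↭-trans (++⁺ʳ (v ∷ ρ) (↭-reverse π)) (shift v π ρ)

∈-reverse-++ : ∀ {u} π v ρ → u ∈ reverse π ++ v ∷ ρ → u ∈ v ∷ π ++ ρ
∈-reverse-++ π v ρ = ∈-resp-↭ (reverse-++-↭ π v ρ)

module _ (ρ : List ℕ) (F : List ℕ → ℤ) (F≡signedAlt : ∀ β → Distinct β → F β ≡ signedAlt ρ β)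
         (r : ℕ) (1≤r : 1 ≤ r) where

  moveBeadsTerm : List ℕ → ℕ → List ℕ → ℤ
  moveBeadsTerm done b rest =
    if (r ≤ᵇ b) ∧ not (member (b ∸ r) (done ++ b ∷ rest))
      then signℤ (countBetween (b ∸ r) b (done ++ rest)) *ℤ F (done ++ (b ∸ r) ∷ rest)
      else 0ℤ

  -- moveBeads keeps the beads already passed in reverse order; signedAlt and countBetween do not see this.
  moveBeadsTerm-free : ∀ π {b′ b} rest → b′ < b → b′ ∉ π ++ rest → Distinct (π ++ b ∷ rest) →
    signℤ (countBetween b′ b (reverse π ++ rest)) *ℤ F (reverse π ++ b′ ∷ rest)
      ≡ sortSign (π ++ b ∷ rest) *ℤ mnAlt (π ++ b′ ∷ rest) ρ
  moveBeadsTerm-free π {b′} {b} rest b′<b b′∉ d = begin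
    signℤ (countBetween b′ b (reverse π ++ rest)) *ℤ F (reverse π ++ b′ ∷ rest)
      ≡⟨ cong₂ _*ℤ_ (cong signℤ (countBetween-↭ b′ b (++⁺ʳ rest (↭-reverse π))))
                    (trans (F≡signedAlt _ (distinct-↭ (↭-sym unreverse) d′)) (signedAlt-↭ ρ unreverse)) ⟩
    s *ℤ (sortSign (π ++ b′ ∷ rest) *ℤ mnAlt (π ++ b′ ∷ rest) ρ)
      ≡⟨ ℤ.*-assoc s (sortSign (π ++ b′ ∷ rest)) (mnAlt (π ++ b′ ∷ rest) ρ) ⟨
    (s *ℤ sortSign (π ++ b′ ∷ rest)) *ℤ mnAlt (π ++ b′ ∷ rest) ρ
      ≡⟨ cong (_*ℤ mnAlt (π ++ b′ ∷ rest) ρ) (sortSign-lower π rest b′<b (distinct⇒∉ π rest d) b′∉) ⟨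
    sortSign (π ++ b ∷ rest) *ℤ mnAlt (π ++ b′ ∷ rest) ρ
      ∎
    where
    open ≡-Reasoning
    s : ℤ
    s = signℤ (countBetween b′ b (π ++ rest))
    unreverse : reverse π ++ b′ ∷ rest ↭ π ++ b′ ∷ rest
    unreverse = ++⁺ʳ (b′ ∷ rest) (↭-reverse π)
    d′ : Distinct (π ++ b′ ∷ rest)
    d′ = distinct-lower π rest b′<b b′∉ d

  collision-vanishes : ∀ π {b} rest → r ≤ b → b ∸ r ∈ reverse π ++ b ∷ rest →
    mnAlt (π ++ (b ∸ r) ∷ rest) ρ ≡ 0ℤ
  collision-vanishes π {b} rest r≤b hit with ∈-reverse-++ π b rest hit
  ... | here b∸r≡b  = contradiction b∸r≡b (ℕ.<⇒≢ (ℕ.∸-monoʳ-< 1≤r r≤b))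
  ... | there b∸r∈ = alternating-∈ (λ β → mnAlt β ρ) (mnAlt-alternating ρ) π rest b∸r∈

  moveBeadsTerm-signedAlt : ∀ π b rest → Distinct (π ++ b ∷ rest) →
    moveBeadsTerm (reverse π) b rest
      ≡ sortSign (π ++ b ∷ rest) *ℤ (if r ≤ᵇ b then mnAlt (π ++ (b ∸ r) ∷ rest) ρ else 0ℤ)
  moveBeadsTerm-signedAlt π b rest d with r ≤ᵇ b | ≤ᵇ-reflects-≤ r b
  ... | false | _       = sym (ℤ.*-zeroʳ (sortSign (π ++ b ∷ rest)))
  ... | true  | ofʸ r≤b
    with member (b ∸ r) (reverse π ++ b ∷ rest) | member-reflects (b ∸ r) (reverse π ++ b ∷ rest)
  ...   | true  | ofʸ hit  = sym (trans (cong (sortSign (π ++ b ∷ rest) *ℤ_) (collision-vanishes π rest r≤b hit))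
                                     (ℤ.*-zeroʳ (sortSign (π ++ b ∷ rest))))
  ...   | false | ofⁿ miss = moveBeadsTerm-free π rest (ℕ.∸-monoʳ-< 1≤r r≤b)
                               (miss ∘ ∈-resp-↭ (↭-sym (reverse-++-↭ π b rest)) ∘ there) d

  moveBeads-signedAlt : ∀ rest π → Distinct (π ++ rest) →
    moveBeads F r (reverse π) rest ≡ sortSign (π ++ rest) *ℤ Σ-lower r (λ γ → mnAlt (π ++ γ) ρ) rest
  moveBeads-signedAlt []         π d = sym (ℤ.*-zeroʳ (sortSign (π ++ [])))
  moveBeads-signedAlt (b ∷ rest) π d = begin
    moveBeadsTerm (reverse π) b rest +ℤ moveBeads F r (b ∷ reverse π) rest
      ≡⟨ cong₂ _+ℤ_ (moveBeadsTerm-signedAlt π b rest d) later ⟩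
    S *ℤ headTerm +ℤ S *ℤ tailSum
      ≡⟨ ℤ.*-distribˡ-+ S headTerm tailSum ⟨
    S *ℤ Σ-lower r (λ γ → mnAlt (π ++ γ) ρ) (b ∷ rest)
      ∎
    where
    open ≡-Reasoning
    S headTerm tailSum : ℤ
    S = sortSign (π ++ b ∷ rest)
    headTerm = if r ≤ᵇ b then mnAlt (π ++ (b ∸ r) ∷ rest) ρ else 0ℤ
    tailSum = Σ-lower r (λ γ → mnAlt (π ++ b ∷ γ) ρ) rest
    later : moveBeads F r (b ∷ reverse π) rest ≡ S *ℤ tailSum
    later = begin
      moveBeads F r (b ∷ reverse π) rest
        ≡⟨ cong (λ done → moveBeads F r done rest) (List.reverse-++ π [ b ]) ⟨
      moveBeads F r (reverse (π ++ [ b ])) rest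
        ≡⟨ moveBeads-signedAlt rest (π ++ [ b ]) (subst Distinct (sym (List.++-assoc π [ b ] rest)) d) ⟩
      sortSign ((π ++ [ b ]) ++ rest) *ℤ Σ-lower r (λ γ → mnAlt ((π ++ [ b ]) ++ γ) ρ) rest
        ≡⟨ cong₂ _*ℤ_ (cong sortSign (List.++-assoc π [ b ] rest))
                      (Σ-lower-cong r rest (λ γ → cong (λ β → mnAlt β ρ) (List.++-assoc π [ b ] γ))) ⟩
      S *ℤ tailSum
        ∎

mnβ≡signedAlt : ∀ ρ → All (1 ≤_) ρ → ∀ β → Distinct β → mnβ β ρ ≡ signedAlt ρ β
mnβ≡signedAlt []      _            β d = sym d
mnβ≡signedAlt (r ∷ ρ) (1≤r ∷ 1≤ρ) β d =
  moveBeads-signedAlt ρ (λ β′ → mnβ β′ ρ) (mnβ≡signedAlt ρ 1≤ρ) r 1≤r β [] d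

open BinomialSums ℤ.+-*-commutativeRing

ones : ℕ → List ℕ
ones j = replicate j 1

mnAltTail : ℕ → List ℕ → List ℕ → ℤ
mnAltTail u γ []      = sortSign (u ∷ γ)
mnAltTail u γ (r ∷ ρ) = Σ-lower r (λ δ → mnAltTail u δ ρ) γ

-- J of the j unit moves lower the tail γ, the other j ∸ J lower the head bead x, which must stay ≥ 0.
onesTerm : ℕ → ℕ → ℕ → List ℕ → ℤ
onesTerm x j J γ = if j ≤ᵇ J + x then mnAltTail ((J + x) ∸ j) γ (ones J) else 0ℤ

onesCoeff : ℕ → List ℕ → ℕ → ℤ
onesCoeff e γ J = if e ≤ᵇ J then mnAltTail (J ∸ e) γ (ones J) else 0ℤ

≤ᵇ-suc : ∀ m n → (suc m ≤ᵇ suc n) ≡ (m ≤ᵇ n)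
≤ᵇ-suc zero    n = refl
≤ᵇ-suc (suc m) n = refl

≤ᵇ-+ˡ : ∀ y m n → (y + m ≤ᵇ y + n) ≡ (m ≤ᵇ n)
≤ᵇ-+ˡ zero    m n = refl
≤ᵇ-+ˡ (suc y) m n = trans (≤ᵇ-suc (y + m) (y + n)) (≤ᵇ-+ˡ y m n)

Σ-lower-0 : ∀ r β → Σ-lower r (λ _ → 0ℤ) β ≡ 0ℤ
Σ-lower-0 r []      = refl
Σ-lower-0 r (z ∷ β) with r ≤ᵇ z
... | true  = cong (0ℤ +ℤ_) (Σ-lower-0 r β)
... | false = cong (0ℤ +ℤ_) (Σ-lower-0 r β)

Σ-lower-if : ∀ r c f γ → Σ-lower r (λ δ → if c then f δ else 0ℤ) γ ≡ (if c then Σ-lower r f γ else 0ℤ)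
Σ-lower-if r true  f γ = refl
Σ-lower-if r false f γ = Σ-lower-0 r γ

Σ-lower-binomialSum : ∀ r K j (h : ℕ → List ℕ → ℤ) γ →
  Σ-lower r (λ δ → binomialSum K (λ J → h J δ) j) γ ≡ binomialSum K (λ J → Σ-lower r (h J) γ) j
Σ-lower-binomialSum r K j h []      = sym (Σ≤-zero K (λ J _ → ℤ.*-zeroʳ (binom j J)))
Σ-lower-binomialSum r K j h (z ∷ γ) with r ≤ᵇ z
... | true  = trans (cong (binomialSum K (λ J → h J ((z ∸ r) ∷ γ)) j +ℤ_)
                          (Σ-lower-binomialSum r K j (λ J → h J ∘ (z ∷_)) γ))
                    (sym (binomialSum-distrib-+ K (λ J → h J ((z ∸ r) ∷ γ))
                                                  (λ J → Σ-lower r (h J ∘ (z ∷_)) γ) j))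
... | false = trans (ℤ.+-identityˡ _)
                    (trans (Σ-lower-binomialSum r K j (λ J → h J ∘ (z ∷_)) γ)
                           (binomialSum-congᵇ K j (λ J _ → sym (ℤ.+-identityˡ (Σ-lower r (h J ∘ (z ∷_)) γ)))))

mnAlt-head-ones : ∀ j x γ → mnAlt (x ∷ γ) (ones j) ≡ binomialSum j (λ J → onesTerm x j J γ) j
mnAlt-head-ones zero    x γ = sym (ℤ.*-identityˡ (sortSign (x ∷ γ)))
mnAlt-head-ones (suc j) x γ = begin
  (if 1 ≤ᵇ x then mnAlt ((x ∸ 1) ∷ γ) (ones j) else 0ℤ) +ℤ Σ-lower 1 (λ δ → mnAlt (x ∷ δ) (ones j)) γ
    ≡⟨ cong₂ _+ℤ_ (head-moves x) tail-moves ⟩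
  binomialSum j g j +ℤ binomialSum j (g ∘ suc) j
    ≡⟨ cong (_+ℤ binomialSum j (g ∘ suc) j) (binomialSum-beyond g j (ℕ.n≤1+n j)) ⟨
  binomialSum (suc j) g j +ℤ binomialSum j (g ∘ suc) j
    ≡⟨ binomialSum-pascal j g j ⟨
  binomialSum (suc j) g (suc j)
    ∎
  where
  open ≡-Reasoning
  g : ℕ → ℤ
  g J = onesTerm x (suc j) J γ
  head-moves : ∀ x → (if 1 ≤ᵇ x then mnAlt ((x ∸ 1) ∷ γ) (ones j) else 0ℤ)
                     ≡ binomialSum j (λ J → onesTerm x (suc j) J γ) j
  head-moves zero    =
    sym (Σ≤-zero j (λ J J≤j → trans (cong (binom j J *ℤ_) (exhausted J J≤j)) (ℤ.*-zeroʳ (binom j J))))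
    where
    exhausted : ∀ J → J ≤ j → onesTerm zero (suc j) J γ ≡ 0ℤ
    exhausted J J≤j with suc j ≤ᵇ J + 0 | ≤ᵇ-reflects-≤ (suc j) (J + 0)
    ... | false | _          = refl
    ... | true  | ofʸ j<J+0 = contradiction J≤j (ℕ.<⇒≱ (subst (suc j ≤_) (ℕ.+-identityʳ J) j<J+0))
  head-moves (suc x) = trans (mnAlt-head-ones j x γ) (binomialSum-congᵇ j j (λ J _ → head-lowered J))
    where
    head-lowered : ∀ J → onesTerm x j J γ ≡ onesTerm (suc x) (suc j) J γ
    head-lowered J rewrite ℕ.+-suc J x | ≤ᵇ-suc j (J + x) = refl
  tail-moves : Σ-lower 1 (λ δ → mnAlt (x ∷ δ) (ones j)) γ ≡ binomialSum j (g ∘ suc) j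
  tail-moves = begin
    Σ-lower 1 (λ δ → mnAlt (x ∷ δ) (ones j)) γ
      ≡⟨ Σ-lower-cong 1 γ (mnAlt-head-ones j x) ⟩
    Σ-lower 1 (λ δ → binomialSum j (λ J → onesTerm x j J δ) j) γ
      ≡⟨ Σ-lower-binomialSum 1 j j (onesTerm x j) γ ⟩
    binomialSum j (λ J → Σ-lower 1 (onesTerm x j J) γ) j
      ≡⟨ binomialSum-congᵇ j j (λ J _ → trans (Σ-lower-if 1 (j ≤ᵇ J + x) _ γ) (one-more J)) ⟩
    binomialSum j (g ∘ suc) j
      ∎
    where
    one-more : ∀ J → (if j ≤ᵇ J + x then mnAltTail ((J + x) ∸ j) γ (ones (suc J)) else 0ℤ) ≡ g (suc J)
    one-more J = cong (λ c → if c then mnAltTail ((J + x) ∸ j) γ (ones (suc J)) else 0ℤ)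
                      (sym (≤ᵇ-suc j (J + x)))

Σ-lower-congᵇ : ∀ r {f g} β → (∀ δ → sum δ + r ≡ sum β → f δ ≡ g δ) → Σ-lower r f β ≡ Σ-lower r g β
Σ-lower-congᵇ r []      f≡g = refl
Σ-lower-congᵇ r {f} {g} (z ∷ β) f≡g =
  cong₂ _+ℤ_ lowered (Σ-lower-congᵇ r β (λ δ s → f≡g (z ∷ δ) (tail δ s)))
  where
  tail : ∀ δ → sum δ + r ≡ sum β → z + sum δ + r ≡ z + sum β
  tail δ s = trans (ℕ.+-assoc z (sum δ) r) (cong (_+_ z) s)
  lowered : (if r ≤ᵇ z then f ((z ∸ r) ∷ β) else 0ℤ) ≡ (if r ≤ᵇ z then g ((z ∸ r) ∷ β) else 0ℤ)
  lowered with r ≤ᵇ z | ≤ᵇ-reflects-≤ r z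
  ... | false | _       = refl
  ... | true  | ofʸ r≤z = f≡g _ (begin
    (z ∸ r) + sum β + r  ≡⟨ ℕ.+-assoc (z ∸ r) (sum β) r ⟩
    (z ∸ r) + (sum β + r) ≡⟨ cong (_+_ (z ∸ r)) (ℕ.+-comm (sum β) r) ⟩
    (z ∸ r) + (r + sum β) ≡⟨ ℕ.+-assoc (z ∸ r) r (sum β) ⟨
    (z ∸ r) + r + sum β  ≡⟨ cong (_+ sum β) (ℕ.m∸n+n≡m r≤z) ⟩
    z + sum β            ∎)
    where open ≡-Reasoning

Σ-lower-vanish : ∀ r {f} β → (∀ δ → sum δ + r ≡ sum β → f δ ≡ 0ℤ) → Σ-lower r f β ≡ 0ℤ
Σ-lower-vanish r β f≡0 = trans (Σ-lower-congᵇ r β f≡0) (Σ-lower-0 r β)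

mnAltTail-ones-vanish : ∀ J u γ → sum γ < J → mnAltTail u γ (ones J) ≡ 0ℤ
mnAltTail-ones-vanish (suc J) u γ γ<J =
  Σ-lower-vanish 1 γ (λ δ s → mnAltTail-ones-vanish J u δ (shrinks δ s))
  where
  shrinks : ∀ δ → sum δ + 1 ≡ sum γ → sum δ < J
  shrinks δ s = subst (_≤ J) (sym (trans (ℕ.+-comm 1 (sum δ)) s)) (ℕ.≤-pred γ<J)

onesCoeff-vanish-above : ∀ e γ J → sum γ < J → onesCoeff e γ J ≡ 0ℤ
onesCoeff-vanish-above e γ J γ<J with e ≤ᵇ J
... | true  = mnAltTail-ones-vanish J (J ∸ e) γ γ<J
... | false = refl

onesCoeff-vanish-below : ∀ e γ J → J < e → onesCoeff e γ J ≡ 0ℤ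
onesCoeff-vanish-below e γ J J<e with e ≤ᵇ J | ≤ᵇ-reflects-≤ e J
... | false | _       = refl
... | true  | ofʸ e≤J = contradiction e≤J (ℕ.<⇒≱ J<e)

onesTerm-shift : ∀ y e J γ → onesTerm y (y + e) J γ ≡ onesCoeff e γ J
onesTerm-shift y e J γ rewrite ℕ.+-comm J y | ≤ᵇ-+ˡ y e J | ℕ.[m+n]∸[m+o]≡n∸o y J e = refl

mnAlt-head-ones-coeff : ∀ y e γ {K} → sum γ ≤ K → K ≤ y + e →
  mnAlt (y ∷ γ) (ones (y + e)) ≡ binomialSum K (onesCoeff e γ) (y + e)
mnAlt-head-ones-coeff y e γ {K} γ≤K K≤j = begin
  mnAlt (y ∷ γ) (ones (y + e))
    ≡⟨ mnAlt-head-ones (y + e) y γ ⟩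
  binomialSum (y + e) (λ J → onesTerm y (y + e) J γ) (y + e)
    ≡⟨ binomialSum-congᵇ (y + e) (y + e) (λ J _ → onesTerm-shift y e J γ) ⟩
  binomialSum (y + e) (onesCoeff e γ) (y + e)
    ≡⟨ binomialSum-pad (onesCoeff e γ) (y + e)
         (λ J K<J → onesCoeff-vanish-above e γ J (ℕ.≤-<-trans γ≤K K<J)) K≤j ⟩
  binomialSum K (onesCoeff e γ) (y + e)
    ∎
  where open ≡-Reasoning

-- For large n, the coefficient of C(n - 2, J) in χ^(n-k,λ)(τ), where k = ℓ(λ) + 2 + d and B = betaSet λ.
transpositionCoeff : ℕ → List ℕ → ℕ → ℤ
transpositionCoeff d B J = onesCoeff (2 + d) B J +ℤ Σ-lower 2 (λ γ → onesCoeff d γ J) B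

transpositionCoeff-vanish-below : ∀ d B J → J < d → transpositionCoeff d B J ≡ 0ℤ
transpositionCoeff-vanish-below d B J J<d = cong₂ _+ℤ_
  (onesCoeff-vanish-below (2 + d) B J (ℕ.<-≤-trans J<d (ℕ.m≤n+m d 2)))
  (Σ-lower-vanish 2 B (λ γ _ → onesCoeff-vanish-below d γ J J<d))

transpositionCoeff-vanish-above : ∀ d B J → sum B < J → transpositionCoeff d B J ≡ 0ℤ
transpositionCoeff-vanish-above d B J B<J = cong₂ _+ℤ_
  (onesCoeff-vanish-above (2 + d) B J B<J)
  (Σ-lower-vanish 2 B (λ γ s → onesCoeff-vanish-above d γ J
    (ℕ.≤-<-trans (subst (sum γ ≤_) s (ℕ.m≤m+n (sum γ) 2)) B<J)))

cmpSignsʳ-below : ∀ z γ → All (_< z) γ → cmpSignsʳ z γ ≡ 1ℤ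
cmpSignsʳ-below z []      []         = refl
cmpSignsʳ-below z (w ∷ γ) (w<z ∷ γ<z) rewrite cmpSign-> w<z | cmpSignsʳ-below z γ γ<z = refl

sortSign-decreasing : ∀ {β} → Linked _>_ β → sortSign β ≡ 1ℤ
sortSign-decreasing = go ∘ Linked⇒AllPairs (λ y<x z<y → ℕ.<-trans z<y y<x)
  where
  go : ∀ {β} → AllPairs _>_ β → sortSign β ≡ 1ℤ
  go []                        = refl
  go {z ∷ γ} (γ<z ∷ decreasing) rewrite cmpSignsʳ-below z γ γ<z | go decreasing = refl

betaSet-decreasing : ∀ {μ} → Linked _≥_ μ → Linked _>_ (betaSet μ)
betaSet-decreasing []                         = []
betaSet-decreasing [-]                        = [-]
betaSet-decreasing {m ∷ m′ ∷ μ} (m′≤m ∷ rest) =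
  subst (m′ + length μ <_) (sym (ℕ.+-suc m (length μ))) (s≤s (ℕ.+-monoˡ-≤ (length μ) m′≤m))
  ∷ betaSet-decreasing rest

ones-positive : ∀ j → All (1 ≤_) (ones j)
ones-positive zero    = []
ones-positive (suc j) = s≤s z≤n ∷ ones-positive j

mnβ-transposition : ∀ y d B j → j ≡ y + (2 + d) → ∀ {K} → Linked _>_ ((2 + y) ∷ B) → sum B ≤ K → K ≤ j →
  mnβ ((2 + y) ∷ B) (2 ∷ ones j) ≡ binomialSum K (transpositionCoeff d B) j
mnβ-transposition y d B j refl {K} decreasing B≤K K≤j = begin
  mnβ ((2 + y) ∷ B) (2 ∷ ones j)
    ≡⟨ mnβ≡signedAlt (2 ∷ ones j) (s≤s z≤n ∷ ones-positive j) ((2 + y) ∷ B) distinct ⟩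
  sortSign ((2 + y) ∷ B) *ℤ mnAlt ((2 + y) ∷ B) (2 ∷ ones j)
    ≡⟨ trans (cong (_*ℤ mnAlt ((2 + y) ∷ B) (2 ∷ ones j)) (sortSign-decreasing decreasing))
             (ℤ.*-identityˡ (mnAlt ((2 + y) ∷ B) (2 ∷ ones j))) ⟩
  mnAlt (y ∷ B) (ones j) +ℤ Σ-lower 2 (λ γ → mnAlt ((2 + y) ∷ γ) (ones j)) B
    ≡⟨ cong₂ _+ℤ_ (mnAlt-head-ones-coeff y (2 + d) B B≤K K≤j)
                  (Σ-lower-congᵇ 2 B (λ γ s → head-kept γ (subst (sum γ ≤_) s (ℕ.m≤m+n (sum γ) 2)))) ⟩
  binomialSum K (onesCoeff (2 + d) B) j +ℤ Σ-lower 2 (λ γ → binomialSum K (onesCoeff d γ) j) B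
    ≡⟨ cong (binomialSum K (onesCoeff (2 + d) B) j +ℤ_)
            (Σ-lower-binomialSum 2 K j (λ J γ → onesCoeff d γ J) B) ⟩
  binomialSum K (onesCoeff (2 + d) B) j +ℤ binomialSum K tailCoeff j
    ≡⟨ binomialSum-distrib-+ K (onesCoeff (2 + d) B) tailCoeff j ⟨
  binomialSum K (transpositionCoeff d B) j
    ∎
  where
  open ≡-Reasoning
  tailCoeff : ℕ → ℤ
  tailCoeff J = Σ-lower 2 (λ γ → onesCoeff d γ J) B
  distinct : Distinct ((2 + y) ∷ B)
  distinct = cong (λ s → s *ℤ s) (sortSign-decreasing decreasing)
  j≡ : (2 + y) + d ≡ j
  j≡ = sym (trans (ℕ.+-suc y (suc d)) (cong suc (ℕ.+-suc y d)))
  head-kept : ∀ γ → sum γ ≤ sum B → mnAlt ((2 + y) ∷ γ) (ones j) ≡ binomialSum K (onesCoeff d γ) j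
  head-kept γ γ≤B = subst (λ t → mnAlt ((2 + y) ∷ γ) (ones t) ≡ binomialSum K (onesCoeff d γ) t) j≡
    (mnAlt-head-ones-coeff (2 + y) d γ (ℕ.≤-trans γ≤B B≤K) (subst (K ≤_) (sym j≡) K≤j))

module ℚΣ = BinomialSums ℚ.+-*-commutativeRing

toℚᵘ-toℚ : ∀ i → toℚᵘ (toℚ i) ℚᵘ.≃ ℚᵘ.mkℚᵘ i 0
toℚᵘ-toℚ i = ℚ.toℚᵘ-fromℚᵘ (ℚᵘ.mkℚᵘ i 0)

toℚ-+ : ∀ i j → toℚ (i +ℤ j) ≡ toℚ i +ℚ toℚ j
toℚ-+ i j = ℚ.toℚᵘ-injective (ℚᵘ.≃-trans (toℚᵘ-toℚ (i +ℤ j)) (ℚᵘ.≃-trans (ℚᵘ.*≡* (clear i j))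
  (ℚᵘ.≃-sym (ℚᵘ.≃-trans (ℚ.toℚᵘ-homo-+ (toℚ i) (toℚ j)) (ℚᵘ.+-cong (toℚᵘ-toℚ i) (toℚᵘ-toℚ j))))))
  where
  clear : ∀ i j → (i +ℤ j) *ℤ + 1 ≡ (i *ℤ + 1 +ℤ j *ℤ + 1) *ℤ + 1
  clear = solve-∀

toℚ-* : ∀ i j → toℚ (i *ℤ j) ≡ toℚ i *ℚ toℚ j
toℚ-* i j = ℚ.toℚᵘ-injective (ℚᵘ.≃-trans (toℚᵘ-toℚ (i *ℤ j)) (ℚᵘ.≃-trans (ℚᵘ.*≡* refl)
  (ℚᵘ.≃-sym (ℚᵘ.≃-trans (ℚ.toℚᵘ-homo-* (toℚ i) (toℚ j)) (ℚᵘ.*-cong (toℚᵘ-toℚ i) (toℚᵘ-toℚ j))))))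

toℚ-pos : ∀ n → toℚ (+ n) ≡ ℚΣ.ι n
toℚ-pos zero    = refl
toℚ-pos (suc n) = trans (toℚ-+ (+ 1) (+ n)) (cong (1ℚ +ℚ_) (toℚ-pos n))

ι≡pos : ∀ n → ι n ≡ + n
ι≡pos zero    = refl
ι≡pos (suc n) = cong (1ℤ +ℤ_) (ι≡pos n)

toℚ-binom : ∀ j J → toℚ (binom j J) ≡ ℚΣ.binom j J
toℚ-binom j J = trans (cong toℚ (ι≡pos (j C J))) (toℚ-pos (j C J))

toℚ-Σ≤ : ∀ K f → toℚ (Σ≤ K f) ≡ ℚΣ.Σ≤ K (toℚ ∘ f)
toℚ-Σ≤ zero    f = refl
toℚ-Σ≤ (suc K) f = trans (toℚ-+ (Σ≤ K f) (f (suc K))) (cong (_+ℚ toℚ (f (suc K))) (toℚ-Σ≤ K f))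

toℚ-binomialSum : ∀ K a j → toℚ (binomialSum K a j) ≡ ℚΣ.binomialSum K (toℚ ∘ a) j
toℚ-binomialSum K a j = trans (toℚ-Σ≤ K _)
  (ℚΣ.Σ≤-cong K (λ J → trans (toℚ-* (binom j J) (a J)) (cong (_*ℚ toℚ (a J)) (toℚ-binom j J))))

Σ0to≡Σ≤ : ∀ K f → Σ0to K f ≡ ℚΣ.Σ≤ K f
Σ0to≡Σ≤ zero    f = refl
Σ0to≡Σ≤ (suc K) f = cong (_+ℚ f (suc K)) (Σ0to≡Σ≤ K f)

binomExpansion≡binomialSum : ∀ k b j →
  binomExpansion k b (2 + j) ≡ ℚΣ.binomialSum k (λ J → signℚ (k ∸ J) *ℚ b (k ∸ J)) j
binomExpansion≡binomialSum k b j = begin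
  Σ0to k term                     ≡⟨ Σ0to≡Σ≤ k term ⟩
  ℚΣ.Σ≤ k term                    ≡⟨ ℚΣ.Σ≤-reverse k term ⟩
  ℚΣ.Σ≤ k (λ J → term (k ∸ J))    ≡⟨ ℚΣ.Σ≤-congᵇ k reindex ⟩
  ℚΣ.binomialSum k (λ J → signℚ (k ∸ J) *ℚ b (k ∸ J)) j ∎
  where
  open ≡-Reasoning
  term : ℕ → ℚ
  term h = signℚ h *ℚ (b h *ℚ toℚ (+ (j C (k ∸ h))))
  reindex : ∀ J → J ≤ k → term (k ∸ J) ≡ ℚΣ.binom j J *ℚ (signℚ (k ∸ J) *ℚ b (k ∸ J))
  reindex J J≤k rewrite ℕ.m∸[m∸n]≡n J≤k | toℚ-pos (j C J) =
    trans (sym (ℚ.*-assoc (signℚ (k ∸ J)) (b (k ∸ J)) _)) (ℚ.*-comm _ (ℚΣ.binom j J))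

signℚ-cancel : ∀ h {x} → signℚ h *ℚ x ≡ 0ℚ → x ≡ 0ℚ
signℚ-cancel h {x} sx≡0 = begin
  x                 ≡⟨ ℚ.*-identityˡ x ⟨
  1ℚ *ℚ x           ≡⟨ cong (_*ℚ x) square ⟨
  (s *ℚ s) *ℚ x     ≡⟨ ℚ.*-assoc s s x ⟩
  s *ℚ (s *ℚ x)     ≡⟨ cong (s *ℚ_) sx≡0 ⟩
  s *ℚ 0ℚ           ≡⟨ ℚ.*-zeroʳ s ⟩
  0ℚ                ∎
  where
  open ≡-Reasoning
  s : ℚ
  s = signℚ h
  square : s *ℚ s ≡ 1ℚ
  square = trans (sym (toℚ-* (signℤ h) (signℤ h))) (cong toℚ (signℤ-square h))

Linked-≥-cons : ∀ {t μ} → largestPart μ ≤ t → Linked _≥_ μ → Linked _≥_ (t ∷ μ)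
Linked-≥-cons {μ = []}    _    _          = [-]
Linked-≥-cons {μ = _ ∷ _} μ₁≤t decreasing = μ₁≤t ∷ decreasing

χ-transposition : ∀ {lam k} d → Linked _≥_ lam → k ≡ (length lam + 2) + d → ∀ j →
  k + largestPart lam ≤ j → sum (betaSet lam) ≤ j →
  χ ((2 + j ∸ k) ∷ lam) (transpositionType (2 + j))
    ≡ binomialSum (sum (betaSet lam)) (transpositionCoeff d (betaSet lam)) j
χ-transposition {lam} {k} d decreasing refl j k+λ₁≤j B≤j = begin
  χ ((2 + j ∸ k) ∷ lam) (2 ∷ ones j)
    ≡⟨ cong (λ t → χ (t ∷ lam) (2 ∷ ones j)) (ℕ.+-∸-assoc 2 k≤j) ⟩
  mnβ ((2 + y) ∷ B) (2 ∷ ones j)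
    ≡⟨ mnβ-transposition y d B j j≡ (betaSet-decreasing (Linked-≥-cons λ₁≤ decreasing)) ℕ.≤-refl B≤j ⟩
  binomialSum (sum B) (transpositionCoeff d B) j
    ∎
  where
  open ≡-Reasoning
  ℓ m y : ℕ
  ℓ = length lam
  m = j ∸ k
  y = m + ℓ
  B : List ℕ
  B = betaSet lam
  k≤j : k ≤ j
  k≤j = ℕ.m+n≤o⇒m≤o k k+λ₁≤j
  λ₁≤ : largestPart lam ≤ 2 + m
  λ₁≤ = ℕ.≤-trans (subst (_≤ m) (ℕ.m+n∸m≡n k (largestPart lam)) (ℕ.∸-monoˡ-≤ k k+λ₁≤j)) (ℕ.m≤n+m m 2)
  regroup : ∀ m ℓ d → m + ((ℓ + 2) + d) ≡ (m + ℓ) + (2 + d)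
  regroup = ℕ-Solver.solve-∀
  j≡ : j ≡ y + (2 + d)
  j≡ = trans (sym (ℕ.m∸n+n≡m k≤j)) (regroup m ℓ d)

coefficients-agree : ∀ {k lam d} (b : ℕ → ℚ) → Linked _≥_ lam → k ≡ (length lam + 2) + d →
  (∀ n → k + largestPart lam ≤ n → 2 ≤ n →
     toℚ (χ ((n ∸ k) ∷ lam) (transpositionType n)) ≡ binomExpansion k b n) →
  ∀ J → J ≤ k → signℚ (k ∸ J) *ℚ b (k ∸ J) ≡ toℚ (transpositionCoeff d (betaSet lam) J)
coefficients-agree {k} {lam} {d} b decreasing k≡ expansion =
  ℚΣ.binomialSum-injective′ ((k + largestPart lam) + K) (ℕ.m≤m+n k K) agree
  where
  B : List ℕ
  B = betaSet lam
  K : ℕ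
  K = sum B
  agree : ∀ j → (k + largestPart lam) + K ≤ j →
    ℚΣ.binomialSum k (λ J → signℚ (k ∸ J) *ℚ b (k ∸ J)) j
      ≡ ℚΣ.binomialSum (k + K) (toℚ ∘ transpositionCoeff d B) j
  agree j M≤j = begin
    ℚΣ.binomialSum k (λ J → signℚ (k ∸ J) *ℚ b (k ∸ J)) j
      ≡⟨ binomExpansion≡binomialSum k b j ⟨
    binomExpansion k b (2 + j)
      ≡⟨ expansion (2 + j) (ℕ.≤-trans k+λ₁≤j (ℕ.m≤n+m j 2)) (s≤s (s≤s z≤n)) ⟨
    toℚ (χ ((2 + j ∸ k) ∷ lam) (transpositionType (2 + j)))
      ≡⟨ cong toℚ (χ-transposition d decreasing k≡ j k+λ₁≤j (ℕ.m+n≤o⇒n≤o _ M≤j)) ⟩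
    toℚ (binomialSum K (transpositionCoeff d B) j)
      ≡⟨ toℚ-binomialSum K (transpositionCoeff d B) j ⟩
    ℚΣ.binomialSum K (toℚ ∘ transpositionCoeff d B) j
      ≡⟨ ℚΣ.binomialSum-pad (toℚ ∘ transpositionCoeff d B) j
           (λ J K<J → cong toℚ (transpositionCoeff-vanish-above d B J K<J)) (ℕ.m≤n+m K k) ⟨
    ℚΣ.binomialSum (k + K) (toℚ ∘ transpositionCoeff d B) j
      ∎
    where
    open ≡-Reasoning
    k+λ₁≤j : k + largestPart lam ≤ j
    k+λ₁≤j = ℕ.m+n≤o⇒m≤o _ M≤j

<∸2⇒+2< : ∀ ℓ k → ℓ < k ∸ 2 → ℓ + 2 < k
<∸2⇒+2< ℓ (suc (suc k)) ℓ<k = subst (_< 2 + k) (ℕ.+-comm 2 ℓ) (s≤s (s≤s ℓ<k))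

proposition2p2 : (k : ℕ) (lam : List ℕ) → IsPartitionOf lam k →
    (b : ℕ → ℚ) →
    (∀ n → k + largestPart lam ≤ n → 2 ≤ n →
      toℚ (χ ((n ∸ k) ∷ lam) (transpositionType n)) ≡ binomExpansion k b n) →
    (∀ h → length lam + 2 < h → h ≤ k → b h ≡ 0ℚ)
    × (length lam < k ∸ 2 → b k ≡ 0ℚ)
proposition2p2 k lam (_ , decreasing , _) b expansion =
  vanish , λ ℓ<k∸2 → vanish k (<∸2⇒+2< _ k ℓ<k∸2) ℕ.≤-refl
  where
  vanish : ∀ h → length lam + 2 < h → h ≤ k → b h ≡ 0ℚ
  vanish h ℓ+2<h h≤k = signℚ-cancel h (begin
    signℚ h *ℚ b h
      ≡⟨ cong (λ t → signℚ t *ℚ b t) (ℕ.m∸[m∸n]≡n h≤k) ⟨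
    signℚ (k ∸ (k ∸ h)) *ℚ b (k ∸ (k ∸ h))
      ≡⟨ coefficients-agree b decreasing k≡ expansion (k ∸ h) (ℕ.m∸n≤m k h) ⟩
    toℚ (transpositionCoeff d B (k ∸ h))
      ≡⟨ cong toℚ (transpositionCoeff-vanish-below d B (k ∸ h) k∸h<d) ⟩
    0ℚ
      ∎)
    where
    open ≡-Reasoning
    B : List ℕ
    B = betaSet lam
    d : ℕ
    d = k ∸ (length lam + 2)
    k≡ : k ≡ (length lam + 2) + d
    k≡ = sym (ℕ.m+[n∸m]≡n (ℕ.<⇒≤ (ℕ.<-≤-trans ℓ+2<h h≤k)))
    k∸h<d : k ∸ h < d
    k∸h<d = ℕ.∸-monoʳ-< ℓ+2<h h≤k
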